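{- Consider the RDO algorithm on a fixed graph $G$ with fixed preference orders and fixed ranks $\vec y$. Let $M(\vec y)$ be the output matching and $M_u(\vec y)$ the output on $G-\{u\}$ (same ranks and preferences for the remaining vertices). If $u$ is matched in $M(\vec y)$, then the symmetric difference of $M(\vec y)$ and $M_u(\vec y)$ is an alternating path $(u_0=u,u_1,u_2,\ldots)$ such that $(u_i,u_{i+1})\in M(\vec y)$ for all even $i$ and $(u_i,u_{i+1})\in M_u(\vec y)$ for all odd $i$. Moreover, the decision times of the edges along the path are non-decreasing; consequently the vertices $u_1,u_3,\ldots$ are matched no later in $M(\vec y)$ than in $M_u(\vec y)$.
   Context: RDO: each vertex $u$ has a rank (decision time) $y_u\in[0,1]$; vertices are processed in ascending order of ranks; when $u$ is processed, if $u$ is unmatched and has an unmatched neighbor, it is matched to the unmatched neighbor first in its fixed preference order (arbitrary strict total order, independent of ranks). The decision time of an edge $(u,v)$ is $\min\{y_u,y_v\}$ (the only time it can be added); the time a vertex is matched is the decision time of the edge matching it. -}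

module Defs where

open import Data.Nat using (ℕ; zero; suc; _<_; _≤_; _%_)
open import Data.Fin using (Fin; _≟_)
open import Data.Bool using (Bool; true; false; _∧_; not; if_then_else_)
open import Data.Maybe using (Maybe; just; nothing)
open import Data.List using (List; []; _∷_; foldl)
open import Data.Product using (Σ; _×_; _,_)
open import Data.Sum using (_⊎_)
open import Relation.Nullary using (¬_)
open import Relation.Nullary.Decidable using (⌊_⌋)
open import Relation.Binary.PropositionalEquality using (_≡_)
open import Data.Rational as ℚ using (ℚ; _⊓_)

Graph : ℕ → Set
Graph n = Fin n → Fin n → Bool

IsSimpleGraph : ∀ {n} → Graph n → Set
IsSimpleGraph {n} E = ((a b : Fin n) → E a b ≡ E b a) × ((a : Fin n) → E a a ≡ false)

-- G - {u}: delete vertex u (all its incident edges); vertex set kept as Fin n,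
-- u simply becomes isolated, which does not affect RDO.
deleteVertex : ∀ {n} → Graph n → Fin n → Graph n
deleteVertex E u a b = E a b ∧ not ⌊ a ≟ u ⌋ ∧ not ⌊ b ≟ u ⌋

Mate : ℕ → Set
Mate n = Fin n → Maybe (Fin n)

emptyMate : ∀ {n} → Mate n
emptyMate _ = nothing

isFree : ∀ {n} → Mate n → Fin n → Bool
isFree m w with m w
... | nothing = true
... | just _  = false

firstFree : ∀ {n} → Graph n → Mate n → Fin n → List (Fin n) → Maybe (Fin n)
firstFree E m v [] = nothing
firstFree E m v (w ∷ ws) = if E v w ∧ isFree m w then just w else firstFree E m v ws

addEdge : ∀ {n} → Mate n → Fin n → Fin n → Mate n
addEdge m v w x =
  if ⌊ x ≟ v ⌋ then just w else (if ⌊ x ≟ w ⌋ then just v else m x)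

step : ∀ {n} → Graph n → (Fin n → List (Fin n)) → Mate n → Fin n → Mate n
step E pref m v with m v
... | just _ = m
... | nothing with firstFree E m v (pref v)
...   | nothing = m
...   | just w  = addEdge m v w

-- RDO: process the vertices in the given order (the order of ascending rank)
RDO : ∀ {n} → Graph n → (Fin n → List (Fin n)) → List (Fin n) → Mate n
RDO E pref σ = foldl (step E pref) emptyMate σ

InMatching : ∀ {n} → Mate n → Fin n → Fin n → Set
InMatching m a b = m a ≡ just b

InSymDiff : ∀ {n} → Mate n → Mate n → Fin n → Fin n → Set
InSymDiff m m' a b = (InMatching m a b × ¬ InMatching m' a b) ⊎ (InMatching m' a b × ¬ InMatching m a b)

decisionTime : ∀ {n} → (Fin n → ℚ) → Fin n → Fin n → ℚ
decisionTime y a b = y a ⊓ y b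

Even Odd : ℕ → Set
Even i = i % 2 ≡ 0
Odd i = i % 2 ≡ 1

OnPath : ∀ {n} → (ℕ → Fin n) → ℕ → Fin n → Fin n → Set
OnPath p L a b = Σ ℕ λ i → i < L × ((a ≡ p i × b ≡ p (suc i)) ⊎ (b ≡ p i × a ≡ p (suc i)))

{-# OPTIONS --safe #-}

-- Run RDO on G and on G - u side by side, one vertex at a time.  Invariant: the two
-- matchings agree off a path u = p 0, …, p L whose i-th edge lies in the matching of G
-- for even i and in that of G - u for odd i, and whose end p L is free on the side owning edge L.
-- Processing v changes nothing if v is matched on both sides or interior to the path; if v = p L,
-- its choice can only extend the path.  If v is off the path, both runs see the same available
-- neighbours except p L, so either they add the same edge, or the run owning edge L takes
-- (p L , v) and the other run's choice for v extends the path once more.  Each new edge is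
-- decided at time y v: the previous path edge was decided before v was processed, and the newly
-- chosen vertex, being still free, comes after v; so decision times along the path never drop.
module Submission where

open import Defs
open import Data.Bool using (Bool; true; false; _∧_)
open import Data.Bool.Properties using (∧-zeroʳ; ∧-identityʳ; ∧-conicalˡ; ∧-conicalʳ)
open import Data.Empty using (⊥-elim)
open import Data.Fin using (Fin; _≟_)
open import Data.List using (List; []; _∷_; _++_; [_]; foldl; allFin)
open import Data.List.Properties using (++-assoc)
open import Data.List.Membership.Propositional using (_∈_)
open import Data.List.Membership.Propositional.Properties using (∈-++⁺ˡ; ∈-++⁺ʳ; ∈-++⁻; ∈-allFin)
open import Data.List.Relation.Binary.Permutation.Propositional using (_↭_; ↭-sym)
open import Data.List.Relation.Binary.Permutation.Propositional.Properties using (∈-resp-↭)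
open import Data.List.Relation.Unary.All as All using ()
open import Data.List.Relation.Unary.AllPairs using (AllPairs; _∷_)
open import Data.List.Relation.Unary.Any using (here; there)
open import Data.Maybe using (just; nothing)
open import Data.Maybe.Properties using (just-injective)
open import Data.Nat as ℕ using (ℕ; zero; suc; _≤_; _<_; z≤n)
import Data.Nat.Properties as ℕ
open import Data.Product using (Σ; ∃; _×_; _,_; proj₁; proj₂)
open import Data.Rational as ℚ using (ℚ; 0ℚ; 1ℚ)
import Data.Rational.Properties as ℚ
open import Data.Sum as Sum using (_⊎_; inj₁; inj₂)
open import Relation.Nullary using (¬_; yes; no)
open import Relation.Binary.PropositionalEquality
  using (_≡_; _≢_; refl; sym; trans; cong; cong₂; cong-app; subst; subst₂)

private
  variable
    n : ℕ

data Side : Set where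
  full deleted : Side

other : Side → Side
other full    = deleted
other deleted = full

other-involutive : ∀ s → other (other s) ≡ s
other-involutive full    = refl
other-involutive deleted = refl

s≢other-s : ∀ s → s ≢ other s
s≢other-s full    ()
s≢other-s deleted ()

side-dichotomy : ∀ s t → t ≡ s ⊎ t ≡ other s
side-dichotomy full    full    = inj₁ refl
side-dichotomy full    deleted = inj₂ refl
side-dichotomy deleted full    = inj₂ refl
side-dichotomy deleted deleted = inj₁ refl

both-sides : ∀ {ℓ} {P : Side → Set ℓ} s → P s → P (other s) → ∀ t → P t
both-sides s Ps Pother t with side-dichotomy s t
... | inj₁ refl = Ps
... | inj₂ refl = Pother

-- Edge i of the alternating path belongs to the run on side (side i): G for even i, G - u for odd i.
side : ℕ → Side
side zero    = full
side (suc i) = other (side i)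

side-even : ∀ i → Even i → side i ≡ full
side-even zero          _ = refl
side-even (suc zero)    ()
side-even (suc (suc i)) e = trans (other-involutive (side i)) (side-even i e)

side-odd : ∀ i → Odd i → side i ≡ deleted
side-odd zero          ()
side-odd (suc zero)    _ = refl
side-odd (suc (suc i)) o = trans (other-involutive (side i)) (side-odd i o)

extend : ∀ {A : Set} → (ℕ → A) → ℕ → A → ℕ → A
extend p L x i with i ℕ.≟ suc L
... | yes _ = x
... | no  _ = p i

module _ {A : Set} {p : ℕ → A} {L : ℕ} {x : A} where

  extend-last : extend p L x (suc L) ≡ x
  extend-last with suc L ℕ.≟ suc L
  ... | yes _    = refl
  ... | no  L≢L = ⊥-elim (L≢L refl)

  extend-init : ∀ {i} → i ≤ L → extend p L x i ≡ p i
  extend-init {i} i≤L with i ℕ.≟ suc L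
  ... | yes refl = ⊥-elim (ℕ.n≮n L i≤L)
  ... | no  _    = refl

InjectiveUpTo : ∀ {A : Set} → (ℕ → A) → ℕ → Set
InjectiveUpTo p L = ∀ i j → i ≤ L → j ≤ L → p i ≡ p j → i ≡ j

OffPath : (ℕ → Fin n) → ℕ → Fin n → Set
OffPath p L x = ∀ i → i ≤ L → x ≢ p i

onPath? : ∀ (p : ℕ → Fin n) L x → (∃ λ i → i ≤ L × x ≡ p i) ⊎ OffPath p L x
onPath? p zero x with x ≟ p 0
... | yes x≡p0 = inj₁ (0 , z≤n , x≡p0)
... | no  x≢p0 = inj₂ λ { 0 z≤n → x≢p0 }
onPath? p (suc L) x with onPath? p L x | x ≟ p (suc L)
... | inj₁ (i , i≤L , x≡pi) | _        = inj₁ (i , ℕ.m≤n⇒m≤1+n i≤L , x≡pi)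
... | inj₂ _               | yes x≡pL = inj₁ (suc L , ℕ.≤-refl , x≡pL)
... | inj₂ off             | no  x≢pL = inj₂ off′
  where
  off′ : OffPath p (suc L) x
  off′ i i≤1+L with ℕ.m≤n⇒m<n∨m≡n i≤1+L
  ... | inj₁ i<1+L = off i (ℕ.≤-pred i<1+L)
  ... | inj₂ refl  = x≢pL

module _ {p : ℕ → Fin n} {L : ℕ} {x : Fin n} (x-off : OffPath p L x) where

  private
    last : extend p L x (suc L) ≡ x
    last = extend-last {p = p} {L} {x}
    init : ∀ {i} → i ≤ L → extend p L x i ≡ p i
    init = extend-init {p = p} {L} {x}

  extend-injective : InjectiveUpTo p L → InjectiveUpTo (extend p L x) (suc L)
  extend-injective injective i j i≤ j≤ eq with ℕ.m≤n⇒m<n∨m≡n i≤ | ℕ.m≤n⇒m<n∨m≡n j≤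
  ... | inj₁ i< | inj₁ j< = injective i j (ℕ.≤-pred i<) (ℕ.≤-pred j<)
    (trans (sym (init (ℕ.≤-pred i<))) (trans eq (init (ℕ.≤-pred j<))))
  ... | inj₁ i< | inj₂ refl =
    ⊥-elim (x-off i (ℕ.≤-pred i<) (trans (sym last) (trans (sym eq) (init (ℕ.≤-pred i<)))))
  ... | inj₂ refl | inj₁ j< =
    ⊥-elim (x-off j (ℕ.≤-pred j<) (trans (sym last) (trans eq (init (ℕ.≤-pred j<)))))
  ... | inj₂ refl | inj₂ refl = refl

  extend-offPath : ∀ {z} → OffPath (extend p L x) (suc L) z → OffPath p L z × z ≢ x
  extend-offPath z-off =
    (λ i i≤L z≡pi → z-off i (ℕ.m≤n⇒m≤1+n i≤L) (trans z≡pi (sym (init i≤L))))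
    , λ z≡x → z-off (suc L) ℕ.≤-refl (trans z≡x (sym last))

-- Defs.OnPath p L a b unfolds to Σ k (k < L × PathEdge p k a b).
PathEdge : (ℕ → Fin n) → ℕ → Fin n → Fin n → Set
PathEdge p k a b = (a ≡ p k × b ≡ p (suc k)) ⊎ (b ≡ p k × a ≡ p (suc k))

pathEdge-unique : ∀ {p : ℕ → Fin n} {L k k′ a b} → InjectiveUpTo p L → k < L → k′ < L
                → PathEdge p k a b → PathEdge p k′ a b → k ≡ k′
pathEdge-unique inj k<L k′<L (inj₁ (a≡ , _)) (inj₁ (a≡′ , _)) =
  inj _ _ (ℕ.<⇒≤ k<L) (ℕ.<⇒≤ k′<L) (trans (sym a≡) a≡′)
pathEdge-unique inj k<L k′<L (inj₂ (_ , a≡)) (inj₂ (_ , a≡′)) =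
  ℕ.suc-injective (inj _ _ k<L k′<L (trans (sym a≡) a≡′))
pathEdge-unique inj k<L k′<L (inj₁ (a≡ , b≡)) (inj₂ (b≡′ , a≡′)) = ⊥-elim (ℕ.<-asym
  (ℕ.≤-reflexive (sym (inj _ _ (ℕ.<⇒≤ k<L) k′<L (trans (sym a≡) a≡′))))
  (ℕ.≤-reflexive (inj _ _ k<L (ℕ.<⇒≤ k′<L) (trans (sym b≡) b≡′))))
pathEdge-unique inj k<L k′<L (inj₂ (b≡ , a≡)) (inj₁ (a≡′ , b≡′)) = ⊥-elim (ℕ.<-asym
  (ℕ.≤-reflexive (sym (inj _ _ (ℕ.<⇒≤ k′<L) k<L (trans (sym a≡′) a≡))))
  (ℕ.≤-reflexive (inj _ _ k′<L (ℕ.<⇒≤ k<L) (trans (sym b≡′) b≡))))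

IsMatched : Mate n → Fin n → Set
IsMatched m x = ∃ λ a → m x ≡ just a

record Matched (m : Mate n) (a b : Fin n) : Set where
  constructor _,_
  field
    forward  : m a ≡ just b
    backward : m b ≡ just a
open Matched public

matched-resp : ∀ {m m′ : Mate n} {a b} → m′ a ≡ m a → m′ b ≡ m b → Matched m a b → Matched m′ a b
matched-resp a-same b-same (ma , mb) = trans a-same ma , trans b-same mb

record Adds (m m′ : Mate n) (a b : Fin n) : Set where
  field
    left      : m′ a ≡ just b
    right     : m′ b ≡ just a
    elsewhere : ∀ z → z ≢ a → z ≢ b → m′ z ≡ m z

adds-sym : ∀ {m m′ : Mate n} {a b} → Adds m m′ a b → Adds m m′ b a
adds-sym added = record { left = right ; right = left ; elsewhere = λ z z≢b z≢a → elsewhere z z≢a z≢b }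
  where open Adds added

module _ {m : Mate n} {a b : Fin n} where

  addEdge-elsewhere : ∀ z → z ≢ a → z ≢ b → addEdge m a b z ≡ m z
  addEdge-elsewhere z z≢a z≢b with z ≟ a | z ≟ b
  ... | yes z≡a | _       = ⊥-elim (z≢a z≡a)
  ... | no  _   | yes z≡b = ⊥-elim (z≢b z≡b)
  ... | no  _   | no  _   = refl

  addEdge-here : addEdge m a b a ≡ just b
  addEdge-here with a ≟ a
  ... | yes _   = refl
  ... | no  a≢a = ⊥-elim (a≢a refl)

  addEdge-adds : a ≢ b → Adds m (addEdge m a b) a b
  addEdge-adds a≢b = record { left = addEdge-here ; right = right ; elsewhere = addEdge-elsewhere }
    where
    right : addEdge m a b b ≡ just a
    right with b ≟ a | b ≟ b
    ... | yes b≡a | _       = ⊥-elim (a≢b (sym b≡a))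
    ... | no  _   | yes _   = refl
    ... | no  _   | no  b≢b = ⊥-elim (b≢b refl)

  addEdge-keeps-matched : ∀ {z} → IsMatched m z → IsMatched (addEdge m a b) z
  addEdge-keeps-matched {z} (c , mz≡c) with z ≟ a | z ≟ b
  ... | yes _ | _     = b , refl
  ... | no  _ | yes _ = a , refl
  ... | no  _ | no  _ = c , mz≡c

isFree-true : ∀ (m : Mate n) {x} → isFree m x ≡ true → m x ≡ nothing
isFree-true m {x} free with m x
... | nothing = refl

isFree-false : ∀ (m : Mate n) {x} → isFree m x ≡ false → IsMatched m x
isFree-false m {x} taken with m x
... | just a = a , refl

isFree-resp : ∀ (m m′ : Mate n) {x} → m x ≡ m′ x → isFree m x ≡ isFree m′ x
isFree-resp m m′ {x} eq with m x | m′ x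
... | nothing | nothing = refl
... | just _  | just _  = refl
... | nothing | just _  with () ← eq
... | just _  | nothing with () ← eq

isFree-matched : ∀ (m : Mate n) {x} → IsMatched m x → isFree m x ≡ false
isFree-matched m (_ , mx≡a) rewrite mx≡a = refl

SymmetricGraph : Graph n → Set
SymmetricGraph G = ∀ a b → G a b ≡ G b a

Loopless : Graph n → Set
Loopless G = ∀ a → G a a ≡ false

Isolated : Graph n → Fin n → Set
Isolated G x = ∀ w → G x w ≡ false

loopless-≢ : ∀ {G : Graph n} → Loopless G → ∀ {a b} → G a b ≡ true → a ≢ b
loopless-≢ loopless {a} Gab refl with trans (sym Gab) (loopless a)
... | ()

deleteVertex-symmetric : ∀ (E : Graph n) u → SymmetricGraph E → SymmetricGraph (deleteVertex E u)
deleteVertex-symmetric E u symmetric a b with a ≟ u | b ≟ u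
... | yes _ | yes _ = cong (_∧ false) (symmetric a b)
... | yes _ | no  _ = trans (∧-zeroʳ (E a b)) (sym (∧-zeroʳ (E b a)))
... | no  _ | yes _ = trans (∧-zeroʳ (E a b)) (sym (∧-zeroʳ (E b a)))
... | no  _ | no  _ = cong (_∧ true) (symmetric a b)

deleteVertex-loopless : ∀ (E : Graph n) u → Loopless E → Loopless (deleteVertex E u)
deleteVertex-loopless E u loopless a rewrite loopless a = refl

deleteVertex-isolated : ∀ (E : Graph n) u → Isolated (deleteVertex E u) u
deleteVertex-isolated E u w with u ≟ u
... | yes _   = ∧-zeroʳ (E u w)
... | no  u≢u = ⊥-elim (u≢u refl)

deleteVertex-elsewhere : ∀ (E : Graph n) {u a b} → a ≢ u → b ≢ u → deleteVertex E u a b ≡ E a b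
deleteVertex-elsewhere E {u} {a} {b} a≢u b≢u with a ≟ u | b ≟ u
... | yes a≡u | _       = ⊥-elim (a≢u a≡u)
... | no  _   | yes b≡u = ⊥-elim (b≢u b≡u)
... | no  _   | no  _   = ∧-identityʳ (E a b)

Available : Graph n → Mate n → Fin n → Fin n → Bool
Available G m v w = G v w ∧ isFree m w

-- u is blocked in G - u without being matched.
Blocked : Graph n → Mate n → Fin n → Set
Blocked G m x = IsMatched m x ⊎ Isolated G x

blocked-unavailable : ∀ {G : Graph n} {m} → SymmetricGraph G → ∀ {x} → Blocked G m x
                    → ∀ v → Available G m v x ≡ false
blocked-unavailable {G = G} {m} _ (inj₁ matched) v rewrite isFree-matched m matched = ∧-zeroʳ (G v _)
blocked-unavailable {G = G} symmetric {x} (inj₂ isolated) v rewrite symmetric v x | isolated v = refl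

available-edge : ∀ {G : Graph n} {m v w} → Available G m v w ≡ true → G v w ≡ true
available-edge {G = G} {m} {v} {w} = ∧-conicalˡ (G v w) (isFree m w)

available-free : ∀ {G : Graph n} {m v w} → Available G m v w ≡ true → m w ≡ nothing
available-free {G = G} {m} {v} {w} avail = isFree-true m (∧-conicalʳ (G v w) (isFree m w) avail)

module _ {G : Graph n} {m : Mate n} {v : Fin n} where

  firstFree-available : ∀ xs {w} → firstFree G m v xs ≡ just w → Available G m v w ≡ true
  firstFree-available (x ∷ xs) chosen with Available G m v x in avail
  ... | true  = subst (λ w → Available G m v w ≡ true) (just-injective chosen) avail
  ... | false = firstFree-available xs chosen

  firstFree-nothing : ∀ xs {w} → firstFree G m v xs ≡ nothing → w ∈ xs → Available G m v w ≡ false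
  firstFree-nothing (x ∷ xs) none w∈ with Available G m v x in avail | w∈
  ... | false | here refl = avail
  ... | false | there w∈xs = firstFree-nothing xs none w∈xs

firstFree-except : ∀ {G₁ G₂ : Graph n} {m₁ m₂ v z} xs
  → (∀ w → w ≢ z → Available G₁ m₁ v w ≡ Available G₂ m₂ v w) → Available G₂ m₂ v z ≡ false
  → firstFree G₁ m₁ v xs ≡ firstFree G₂ m₂ v xs ⊎ firstFree G₁ m₁ v xs ≡ just z
firstFree-except [] _ _ = inj₁ refl
firstFree-except {G₁ = G₁} {G₂} {m₁} {m₂} {v} {z} (x ∷ xs) agree z-unavailable with x ≟ z
... | yes refl with Available G₁ m₁ v x
...   | true  = inj₂ refl
...   | false rewrite z-unavailable = firstFree-except xs agree z-unavailable
firstFree-except {G₁ = G₁} {G₂} {m₁} {m₂} {v} {z} (x ∷ xs) agree z-unavailable | no x≢z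
  rewrite agree x x≢z with Available G₂ m₂ v x
... | true  = inj₁ refl
... | false = firstFree-except xs agree z-unavailable

Covered : List (Fin n) → Mate n → Set
Covered P m = ∀ a b → m a ≡ just b → a ∈ P ⊎ b ∈ P

Maximal : Graph n → List (Fin n) → Mate n → Set
Maximal G P m = ∀ x → x ∈ P → m x ≡ nothing → ∀ w → G x w ≡ true → IsMatched m w

module Greedy (pref : Fin n → List (Fin n)) (G : Graph n) where

  chosen-available : ∀ {m : Mate n} {v w} → firstFree G m v (pref v) ≡ just w → Available G m v w ≡ true
  chosen-available {m} {v} = firstFree-available {G = G} {m} {v} (pref v)

  chosen-edge : ∀ {m : Mate n} {v w} → firstFree G m v (pref v) ≡ just w → G v w ≡ true
  chosen-edge {m} {v} chosen = available-edge {G = G} {m} {v} (chosen-available {m} {v} chosen)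

  chosen-free : ∀ {m : Mate n} {v w} → firstFree G m v (pref v) ≡ just w → m w ≡ nothing
  chosen-free {m} {v} chosen = available-free {G = G} {m} {v} (chosen-available {m} {v} chosen)

  step-matched : ∀ {m : Mate n} {v} → IsMatched m v → step G pref m v ≡ m
  step-matched (_ , mv≡a) rewrite mv≡a = refl

  step-stuck : ∀ {m : Mate n} {v} → m v ≡ nothing → firstFree G m v (pref v) ≡ nothing
             → step G pref m v ≡ m
  step-stuck free none rewrite free | none = refl

  step-adds : ∀ {m : Mate n} {v w} → m v ≡ nothing → firstFree G m v (pref v) ≡ just w
            → step G pref m v ≡ addEdge m v w
  step-adds free chosen rewrite free | chosen = refl

  data StepCase (m : Mate n) (v : Fin n) : Set where
    matched : IsMatched m v → step G pref m v ≡ m → StepCase m v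
    stuck   : m v ≡ nothing → firstFree G m v (pref v) ≡ nothing → step G pref m v ≡ m → StepCase m v
    adds    : ∀ {w} → m v ≡ nothing → firstFree G m v (pref v) ≡ just w
            → step G pref m v ≡ addEdge m v w → StepCase m v

  stepCase : ∀ m v → StepCase m v
  stepCase m v with m v in mv | firstFree G m v (pref v) in chosen
  ... | just a  | _       = matched (a , mv) (step-matched (a , mv))
  ... | nothing | nothing = stuck mv chosen (step-stuck mv chosen)
  ... | nothing | just w  = adds mv chosen (step-adds mv chosen)

  step-adds-chosen : Loopless G → ∀ {m : Mate n} {v w} → m v ≡ nothing → firstFree G m v (pref v) ≡ just w
                   → Adds m (step G pref m v) v w
  step-adds-chosen loopless {m} {v} free chosen = subst (λ m′ → Adds m m′ _ _) (sym (step-adds free chosen))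
    (addEdge-adds (loopless-≢ {G = G} loopless (chosen-edge {m} {v} chosen)))

  step-blocked : ∀ {m : Mate n} {v} → Blocked G m v → step G pref m v ≡ m
  step-blocked (inj₁ v-matched) = step-matched v-matched
  step-blocked {m} {v} (inj₂ isolated) with stepCase m v
  ... | matched _ same   = same
  ... | stuck _ _ same   = same
  ... | adds _ chosen _ with () ← trans (sym (chosen-edge {m} {v} chosen)) (isolated _)

  step-keeps-matched : ∀ {m : Mate n} {v x} → IsMatched m x → IsMatched (step G pref m v) x
  step-keeps-matched {m} {v} {x} matched-x with stepCase m v
  ... | matched _ same   = subst (λ m′ → IsMatched m′ x) (sym same) matched-x
  ... | stuck _ _ same   = subst (λ m′ → IsMatched m′ x) (sym same) matched-x
  ... | adds _ _ stepped = subst (λ m′ → IsMatched m′ x) (sym stepped) (addEdge-keeps-matched {m = m} matched-x)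

  step-free⁻ : ∀ {m : Mate n} {v x} → step G pref m v x ≡ nothing → m x ≡ nothing
  step-free⁻ {m} {v} {x} free with m x in mx
  ... | nothing = refl
  ... | just a with () ← trans (sym free) (proj₂ (step-keeps-matched {m} {v} (a , mx)))

  module _ {P : List (Fin n)} {m : Mate n} (v : Fin n) where

    private
      earlier : ∀ {a b} → a ∈ P ⊎ b ∈ P → a ∈ P ++ [ v ] ⊎ b ∈ P ++ [ v ]
      earlier = Sum.map ∈-++⁺ˡ ∈-++⁺ˡ

    covered-step : Covered P m → Covered (P ++ [ v ]) (step G pref m v)
    covered-step covered a b mab with stepCase m v
    ... | matched _ same    = earlier (covered a b (subst (λ m′ → m′ a ≡ just b) same mab))
    ... | stuck _ _ same    = earlier (covered a b (subst (λ m′ → m′ a ≡ just b) same mab))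
    ... | adds {w} _ _ stepped = added (subst (λ m′ → m′ a ≡ just b) stepped mab)
      where
      added : addEdge m v w a ≡ just b → a ∈ P ++ [ v ] ⊎ b ∈ P ++ [ v ]
      added with a ≟ v | a ≟ w
      ... | yes refl | _        = λ _ → inj₁ (∈-++⁺ʳ P (here refl))
      ... | no  _    | yes refl =
        λ w↦b → inj₂ (subst (_∈ P ++ [ v ]) (just-injective w↦b) (∈-++⁺ʳ P (here refl)))
      ... | no  _    | no  _    = λ mab′ → earlier (covered a b mab′)

    maximal-step : (∀ w → w ∈ pref v) → Maximal G P m → Maximal G (P ++ [ v ]) (step G pref m v)
    maximal-step pref-complete maximal x x∈ x-free w Gxw with ∈-++⁻ P x∈
    ... | inj₁ x∈P = step-keeps-matched {m} {v} (maximal x x∈P (step-free⁻ {m} {v} x-free) w Gxw)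
    ... | inj₂ (here refl) with stepCase m x
    ...   | matched (a , mx≡a) same with () ← trans (sym x-free) (trans (cong (λ m′ → m′ x) same) mx≡a)
    ...   | adds {w′} _ _ stepped with () ← trans (sym x-free)
                (trans (cong (λ m′ → m′ x) stepped) (addEdge-here {m = m} {x} {w′}))
    ...   | stuck _ none same = subst (λ m′ → IsMatched m′ w) (sym same)
              (isFree-false m (trans (sym (cong (_∧ isFree m w) Gxw))
                (firstFree-nothing {G = G} {m} {x} (pref x) none (pref-complete w))))

  record Processed (P : List (Fin n)) (m : Mate n) : Set where
    field
      covered : Covered P m
      maximal : Maximal G P m

  processed-[] : Processed [] emptyMate
  processed-[] = record { covered = λ _ _ () ; maximal = λ _ () }

  processed-step : ∀ {P m} v → (∀ w → w ∈ pref v) → Processed P m → Processed (P ++ [ v ]) (step G pref m v)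
  processed-step {P} {m} v pref-complete processed = record
    { covered = covered-step {P} {m} v covered
    ; maximal = maximal-step {P} {m} v pref-complete maximal
    }
    where open Processed processed

  isolated-step : SymmetricGraph G → ∀ {m : Mate n} {x} v → Isolated G x → m x ≡ nothing
                → step G pref m v x ≡ nothing
  isolated-step symmetric {m} {x} v isolated x-free with stepCase m v
  ... | matched _ same = trans (cong (λ m′ → m′ x) same) x-free
  ... | stuck _ _ same = trans (cong (λ m′ → m′ x) same) x-free
  ... | adds {w} _ chosen stepped =
    trans (cong (λ m′ → m′ x) stepped) (trans (addEdge-elsewhere {m = m} x x≢v x≢w) x-free)
    where
    Gvw : G v w ≡ true
    Gvw = chosen-edge {m} {v} chosen
    x≢v : x ≢ v
    x≢v refl with () ← trans (sym Gvw) (isolated w)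
    x≢w : x ≢ w
    x≢w refl with () ← trans (sym Gvw) (trans (symmetric v x) (isolated v))

  rdo-isolated : SymmetricGraph G → ∀ {x} → Isolated G x → ∀ σ → RDO G pref σ x ≡ nothing
  rdo-isolated symmetric {x} isolated = go emptyMate refl
    where
    go : ∀ m → m x ≡ nothing → ∀ σ → foldl (step G pref) m σ x ≡ nothing
    go m x-free []      = x-free
    go m x-free (v ∷ σ) = go (step G pref m v) (isolated-step symmetric {m} v isolated x-free) σ

allPairs-before-middle : ∀ {A : Set} {R : A → A → Set} xs {v ys a}
                       → AllPairs R (xs ++ v ∷ ys) → a ∈ xs → R a v
allPairs-before-middle (x ∷ xs) (x< ∷ _) (here refl) = All.lookup x< (∈-++⁺ʳ xs (here refl))
allPairs-before-middle (x ∷ xs) (_ ∷ sorted) (there a∈xs) = allPairs-before-middle xs sorted a∈xs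

allPairs-middle-after : ∀ {A : Set} {R : A → A → Set} xs {v ys b}
                      → AllPairs R (xs ++ v ∷ ys) → b ∈ ys → R v b
allPairs-middle-after []       (v< ∷ _)      b∈ys = All.lookup v< b∈ys
allPairs-middle-after (x ∷ xs) (_ ∷ sorted) b∈ys = allPairs-middle-after xs sorted b∈ys

module Schedule (y : Fin n → ℚ) {P rest : List (Fin n)} {v : Fin n}
  (sorted : AllPairs (λ a b → y a ℚ.< y b) (P ++ v ∷ rest)) (everyone : ∀ x → x ∈ P ++ v ∷ rest) where

  decided-before : ∀ {m : Mate n} {a b} → Covered P m → m a ≡ just b → decisionTime y a b ℚ.< y v
  decided-before {a = a} {b} covered mab with covered a b mab
  ... | inj₁ a∈P = ℚ.≤-<-trans (ℚ.p⊓q≤p (y a) (y b)) (allPairs-before-middle P sorted a∈P)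
  ... | inj₂ b∈P = ℚ.≤-<-trans (ℚ.p⊓q≤q (y a) (y b)) (allPairs-before-middle P sorted b∈P)

  available-after : ∀ {G : Graph n} {m w} → SymmetricGraph G → Loopless G → Maximal G P m
               → m v ≡ nothing → Available G m v w ≡ true → y v ℚ.< y w
  available-after {G} {m} {w} symmetric loopless maximal v-free avail with ∈-++⁻ P (everyone w)
  ... | inj₁ w∈P with () ← trans (sym v-free) (proj₂ (maximal w w∈P (available-free {G = G} {m} {v} avail) v
                             (trans (symmetric w v) (available-edge {G = G} {m} {v} avail))))
  ... | inj₂ (here refl) = ⊥-elim (loopless-≢ {G = G} loopless (available-edge {G = G} {m} {v} avail) refl)
  ... | inj₂ (there w∈rest) = allPairs-middle-after P sorted w∈rest

module Deletion (E : Graph n) (simple : IsSimpleGraph E) (pref : Fin n → List (Fin n))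
  (pref-complete : ∀ v w → w ∈ pref v) (y : Fin n → ℚ) (u : Fin n) where

  graph : Side → Graph n
  graph full    = E
  graph deleted = deleteVertex E u

  graph-symmetric : ∀ t → SymmetricGraph (graph t)
  graph-symmetric full    = proj₁ simple
  graph-symmetric deleted = deleteVertex-symmetric E u (proj₁ simple)

  graph-loopless : ∀ t → Loopless (graph t)
  graph-loopless full    = proj₂ simple
  graph-loopless deleted = deleteVertex-loopless E u (proj₂ simple)

  graph-away-from-u : ∀ {a b} → a ≢ u → b ≢ u → ∀ s t → graph s a b ≡ graph t a b
  graph-away-from-u a≢u b≢u full    full    = refl
  graph-away-from-u a≢u b≢u full    deleted = sym (deleteVertex-elsewhere E a≢u b≢u)
  graph-away-from-u a≢u b≢u deleted full    = deleteVertex-elsewhere E a≢u b≢u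
  graph-away-from-u a≢u b≢u deleted deleted = refl

  Mates : Set
  Mates = Side → Mate n

  _[_≔_] : Mates → Side → Mate n → Mates
  (M [ full    ≔ m ]) full    = m
  (M [ full    ≔ m ]) deleted = M deleted
  (M [ deleted ≔ m ]) full    = M full
  (M [ deleted ≔ m ]) deleted = m

  update-here : ∀ M s m → (M [ s ≔ m ]) s ≡ m
  update-here M full    m = refl
  update-here M deleted m = refl

  update-other : ∀ M s m → (M [ s ≔ m ]) (other s) ≡ M (other s)
  update-other M full    m = refl
  update-other M deleted m = refl

  stepBoth : Mates → Fin n → Mates
  stepBoth M v t = step (graph t) pref (M t) v

  run-at : ∀ σ (M : Mates) t → foldl stepBoth M σ t ≡ foldl (step (graph t) pref) (M t) σ
  run-at []      M t = refl
  run-at (v ∷ σ) M t = run-at σ (stepBoth M v) t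

  dt : Fin n → Fin n → ℚ
  dt = decisionTime y

  record AlternatingPath (M : Mates) (p : ℕ → Fin n) (L : ℕ) : Set where
    field
      injective : InjectiveUpTo p L
      starts    : p 0 ≡ u
      edge      : ∀ i → i < L → Matched (M (side i)) (p i) (p (suc i))
      agree-off : ∀ x → OffPath p L x → M full x ≡ M deleted x
      end-free  : M (side L) (p L) ≡ nothing
      monotone  : ∀ i → suc i < L → dt (p i) (p (suc i)) ℚ.≤ dt (p (suc i)) (p (suc (suc i)))

  Alternating : Mates → Set
  Alternating M = Σ (ℕ → Fin n) λ p → Σ ℕ λ L → AlternatingPath M p L

  module Path {M : Mates} {p : ℕ → Fin n} {L : ℕ} (alt : AlternatingPath M p L) where
    open AlternatingPath alt

    agree-off-at : ∀ {x} → OffPath p L x → ∀ s t → M s x ≡ M t x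
    agree-off-at         off full    full    = refl
    agree-off-at {x = x} off full    deleted = agree-off x off
    agree-off-at {x = x} off deleted full    = sym (agree-off x off)
    agree-off-at         off deleted deleted = refl

    mate-of-next : ∀ j → j < L → M (other (side (suc j))) (p (suc j)) ≡ just (p j)
    mate-of-next j j<L =
      subst (λ s → M s (p (suc j)) ≡ just (p j)) (sym (other-involutive (side j))) (backward (edge j j<L))

    before-end : ∀ {k} → k < L → p k ≢ p L
    before-end {k} k<L pk≡pL = ℕ.<⇒≢ k<L (injective k L (ℕ.<⇒≤ k<L) ℕ.≤-refl pk≡pL)

    path-blocked : ∀ {i} t → i ≤ L → i < L ⊎ t ≡ other (side L) → Blocked (graph t) (M t) (p i)
    path-blocked {i} t i≤L where-blocked with side-dichotomy (side i) t
    ... | inj₁ refl = inj₁ (_ , forward (edge i (i<L where-blocked)))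
      where
      i<L : i < L ⊎ side i ≡ other (side L) → i < L
      i<L (inj₁ i<L) = i<L
      i<L (inj₂ eq) with ℕ.m≤n⇒m<n∨m≡n i≤L
      ... | inj₁ i<L  = i<L
      ... | inj₂ refl = ⊥-elim (s≢other-s (side i) eq)
    ... | inj₂ refl = entered i i≤L
      where
      entered : ∀ k → k ≤ L → Blocked (graph (other (side k))) (M (other (side k))) (p k)
      entered zero    _   = inj₂ (subst (Isolated (graph deleted)) (sym starts) (deleteVertex-isolated E u))
      entered (suc j) j<L = inj₁ (_ , mate-of-next j j<L)

    path-unavailable : ∀ {i} t v → i ≤ L → i < L ⊎ t ≡ other (side L)
                     → Available (graph t) (M t) v (p i) ≡ false
    path-unavailable t v i≤L where-blocked =
      blocked-unavailable {m = M t} (graph-symmetric t) (path-blocked t i≤L where-blocked) v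

    available-offPath : ∀ {t v w} → Available (graph t) (M t) v w ≡ true
                      → t ≡ other (side L) ⊎ w ≢ p L → OffPath p L w
    available-offPath {t} {v} avail where-blocked i i≤L refl with ℕ.m≤n⇒m<n∨m≡n i≤L | where-blocked
    ... | inj₁ i<L  | _         with () ← trans (sym avail) (path-unavailable t v i≤L (inj₁ i<L))
    ... | inj₂ refl | inj₁ t≡   with () ← trans (sym avail) (path-unavailable t v i≤L (inj₂ t≡))
    ... | inj₂ refl | inj₂ w≢pL = w≢pL refl

    mate-on-path : M deleted u ≡ nothing → ∀ {i t b} → i ≤ L → M t (p i) ≡ just b
                 → (t ≡ side i × i < L × b ≡ p (suc i)) ⊎ (∃ λ j → i ≡ suc j × t ≡ side j × b ≡ p j)
    mate-on-path u-free {i} {t} {b} i≤L mate with side-dichotomy (side i) t | ℕ.m≤n⇒m<n∨m≡n i≤L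
    ... | inj₁ refl | inj₁ i<L  = inj₁ (refl , i<L , just-injective (trans (sym mate) (forward (edge i i<L))))
    ... | inj₁ refl | inj₂ refl with () ← trans (sym end-free) mate
    ... | inj₂ refl | _         = inj₂ (entered i i≤L mate)
      where
      entered : ∀ k → k ≤ L → M (other (side k)) (p k) ≡ just b
              → ∃ λ j → k ≡ suc j × other (side k) ≡ side j × b ≡ p j
      entered zero    _   mate′ with () ← trans (sym u-free) (subst (λ x → M deleted x ≡ just b) starts mate′)
      entered (suc j) j<L mate′ =
        j , refl , other-involutive (side j) , just-injective (trans (sym mate′) (mate-of-next j j<L))

  alternating-resp : ∀ {M N p L} → (∀ t x → M t x ≡ N t x) → AlternatingPath M p L → AlternatingPath N p L
  alternating-resp {M} {N} {p} {L} M≗N alt = record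
    { injective = injective
    ; starts    = starts
    ; edge      = λ i i<L → matched-resp (sym (M≗N (side i) _)) (sym (M≗N (side i) _)) (edge i i<L)
    ; agree-off = λ x off → trans (sym (M≗N full x)) (trans (agree-off x off) (M≗N deleted x))
    ; end-free  = trans (sym (M≗N (side L) (p L))) end-free
    ; monotone  = monotone
    }
    where open AlternatingPath alt

  extend-alternating : ∀ {M N p L x} → AlternatingPath M p L → OffPath p L x → M (side L) x ≡ nothing
    → (∀ j → suc j ≡ L → dt (p j) (p L) ℚ.≤ y x)
    → Adds (M (side L)) (N (side L)) (p L) x → (∀ z → N (other (side L)) z ≡ M (other (side L)) z)
    → AlternatingPath N (extend p L x) (suc L)
  extend-alternating {M} {N} {p} {L} {x} alt x-off x-free last-below added other-same = record
    { injective = extend-injective x-off injective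
    ; starts    = trans (init z≤n) starts
    ; edge      = edge′
    ; agree-off = agree-off′
    ; end-free  = trans (cong (N (other (side L))) last)
                    (trans (other-same x) (trans (agree-off-at x-off (other (side L)) (side L)) x-free))
    ; monotone  = monotone′
    }
    where
    open AlternatingPath alt
    open Path alt
    open Adds added

    init : ∀ {i} → i ≤ L → extend p L x i ≡ p i
    init = extend-init {p = p} {L} {x}
    last : extend p L x (suc L) ≡ x
    last = extend-last {p = p} {L} {x}

    unchanged : ∀ t {z} → z ≢ p L → z ≢ x → N t z ≡ M t z
    unchanged t {z} z≢pL z≢x with side-dichotomy (side L) t
    ... | inj₁ refl = elsewhere z z≢pL z≢x
    ... | inj₂ refl = other-same z

    path≢x : ∀ {k} → k ≤ L → p k ≢ x
    path≢x {k} k≤L pk≡x = x-off k k≤L (sym pk≡x)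

    old-edge : ∀ i → i < L → Matched (N (side i)) (p i) (p (suc i))
    old-edge i i<L with ℕ.m≤n⇒m<n∨m≡n i<L
    ... | inj₁ 1+i<L = matched-resp (unchanged (side i) (before-end i<L) (path≢x (ℕ.<⇒≤ i<L)))
                                    (unchanged (side i) (before-end 1+i<L) (path≢x i<L)) (edge i i<L)
    ... | inj₂ refl  = matched-resp (previous-side _) (previous-side _) (edge i i<L)
      where
      previous-side : ∀ z → N (side i) z ≡ M (side i) z
      previous-side z = subst (λ s → N s z ≡ M s z) (other-involutive (side i)) (other-same z)

    edge′ : ∀ i → i < suc L → Matched (N (side i)) (extend p L x i) (extend p L x (suc i))
    edge′ i i<1+L with ℕ.m<1+n⇒m<n∨m≡n i<1+L
    ... | inj₁ i<L  = subst₂ (Matched (N (side i))) (sym (init (ℕ.<⇒≤ i<L))) (sym (init i<L)) (old-edge i i<L)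
    ... | inj₂ refl = subst₂ (Matched (N (side L))) (sym (init ℕ.≤-refl)) (sym last) (left , right)

    agree-off′ : ∀ z → OffPath (extend p L x) (suc L) z → N full z ≡ N deleted z
    agree-off′ z z-off′ with extend-offPath x-off z-off′
    ... | z-off , z≢x = trans (unchanged full (z-off L ℕ.≤-refl) z≢x)
                          (trans (agree-off z z-off) (sym (unchanged deleted (z-off L ℕ.≤-refl) z≢x)))

    monotone′ : ∀ i → suc i < suc L → dt (extend p L x i) (extend p L x (suc i))
                                  ℚ.≤ dt (extend p L x (suc i)) (extend p L x (suc (suc i)))
    monotone′ i 1+i<1+L with ℕ.m<1+n⇒m<n∨m≡n 1+i<1+L
    ... | inj₁ 1+i<L = subst₂ ℚ._≤_ (sym (cong₂ dt (init (ℕ.≤-trans (ℕ.n≤1+n i) (ℕ.<⇒≤ 1+i<L))) (init (ℕ.<⇒≤ 1+i<L))))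
                                    (sym (cong₂ dt (init (ℕ.<⇒≤ 1+i<L)) (init 1+i<L)))
                                    (monotone i 1+i<L)
    ... | inj₂ refl  = subst₂ ℚ._≤_ (sym (cong₂ dt (init (ℕ.n≤1+n i)) (init ℕ.≤-refl)))
                                    (sym (cong₂ dt (init ℕ.≤-refl) last))
                                    (ℚ.⊓-glb (ℚ.p⊓q≤q (y (p i)) (y (p L))) (last-below i refl))

  last-edge-below : ∀ {p : ℕ → Fin n} {L r} → y (p L) ℚ.≤ r → ∀ j → suc j ≡ L → dt (p j) (p L) ℚ.≤ r
  last-edge-below {p} {L} end≤r j _ = ℚ.≤-trans (ℚ.p⊓q≤q (y (p j)) (y (p L))) end≤r

  add-offPath-edge : ∀ {M N p L v w} → AlternatingPath M p L → OffPath p L v → OffPath p L w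
                   → (∀ t → Adds (M t) (N t) v w) → AlternatingPath N p L
  add-offPath-edge {M} {N} {p} {L} {v} {w} alt v-off w-off added = record
    { injective = injective
    ; starts    = starts
    ; edge      = λ i i<L → matched-resp (on-path (side i) (ℕ.<⇒≤ i<L)) (on-path (side i) i<L) (edge i i<L)
    ; agree-off = agree-off′
    ; end-free  = trans (on-path (side L) ℕ.≤-refl) end-free
    ; monotone  = monotone
    }
    where
    open AlternatingPath alt

    on-path : ∀ t {k} → k ≤ L → N t (p k) ≡ M t (p k)
    on-path t {k} k≤L =
      Adds.elsewhere (added t) (p k) (λ pk≡v → v-off k k≤L (sym pk≡v)) (λ pk≡w → w-off k k≤L (sym pk≡w))

    agree-off′ : ∀ z → OffPath p L z → N full z ≡ N deleted z
    agree-off′ z z-off with z ≟ v | z ≟ w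
    ... | yes refl | _        = trans (Adds.left (added full)) (sym (Adds.left (added deleted)))
    ... | no  _    | yes refl = trans (Adds.right (added full)) (sym (Adds.right (added deleted)))
    ... | no  z≢v  | no  z≢w  = trans (Adds.elsewhere (added full) z z≢v z≢w)
                                  (trans (agree-off z z-off) (sym (Adds.elsewhere (added deleted) z z≢v z≢w)))

  module Step {P rest : List (Fin n)} {v : Fin n}
      (sorted : AllPairs (λ a b → y a ℚ.< y b) (P ++ v ∷ rest)) (everyone : ∀ x → x ∈ P ++ v ∷ rest)
      {M : Mates} (processed : ∀ t → Greedy.Processed pref (graph t) P (M t)) where
    open Schedule y sorted everyone
    module G (t : Side) = Greedy pref (graph t)

    available-after-at : ∀ t {w} → M t v ≡ nothing → Available (graph t) (M t) v w ≡ true → y v ℚ.< y w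
    available-after-at t = available-after (graph-symmetric t) (graph-loopless t) (Greedy.Processed.maximal (processed t))

    unchanged : ∀ {p L} → (∀ t → step (graph t) pref (M t) v ≡ M t) → AlternatingPath M p L
              → Alternating (stepBoth M v)
    unchanged {p} {L} same alt = p , L , alternating-resp (λ t x → sym (cong-app (same t) x)) alt

    module _ {p : ℕ → Fin n} {L : ℕ} (alt : AlternatingPath M p L) where
      open AlternatingPath alt
      open Path alt

      step-on-path-blocked : ∀ t {k} → k ≤ L → v ≡ p k → k < L ⊎ t ≡ other (side L)
                           → step (graph t) pref (M t) v ≡ M t
      step-on-path-blocked t k≤L v≡pk where-blocked =
        G.step-blocked t (subst (Blocked (graph t) (M t)) (sym v≡pk) (path-blocked t k≤L where-blocked))

      only-end-side : v ≡ p L → step (graph (side L)) pref (M (side L)) v ≡ M (side L)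
                    → ∀ t → step (graph t) pref (M t) v ≡ M t
      only-end-side v≡pL same =
        both-sides (side L) same (step-on-path-blocked (other (side L)) ℕ.≤-refl v≡pL (inj₂ refl))

      step-end : v ≡ p L → Alternating (stepBoth M v)
      step-end v≡pL with G.stepCase (side L) (M (side L)) v
      ... | G.matched _ same = unchanged (only-end-side v≡pL same) alt
      ... | G.stuck _ _ same = unchanged (only-end-side v≡pL same) alt
      ... | G.adds {w} free chosen _ = extend p L w , suc L ,
            extend-alternating alt w-off (G.chosen-free (side L) chosen) below
              (subst (λ a → Adds _ _ a w) v≡pL (G.step-adds-chosen (side L) (graph-loopless (side L)) free chosen))
              (cong-app (step-on-path-blocked (other (side L)) ℕ.≤-refl v≡pL (inj₂ refl)))
        where
        avail : Available (graph (side L)) (M (side L)) v w ≡ true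
        avail = G.chosen-available (side L) chosen
        w-off : OffPath p L w
        w-off = available-offPath avail (inj₂ λ w≡pL →
          loopless-≢ (graph-loopless (side L)) (G.chosen-edge (side L) chosen) (trans v≡pL (sym w≡pL)))
        below : ∀ j → suc j ≡ L → dt (p j) (p L) ℚ.≤ y w
        below = last-edge-below (ℚ.<⇒≤ (subst (λ a → y a ℚ.< y w) v≡pL (available-after-at (side L) free avail)))

      module FreeOffPath (v-off : OffPath p L v) (free : ∀ t → M t v ≡ nothing) where
        s : Side
        s = side L

        v≢u : v ≢ u
        v≢u v≡u = v-off 0 z≤n (trans v≡u (sym starts))

        end-unavailable : Available (graph (other s)) (M (other s)) v (p L) ≡ false
        end-unavailable = path-unavailable (other s) v ℕ.≤-refl (inj₂ refl)

        same-availability : ∀ w → w ≢ p L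
                          → Available (graph s) (M s) v w ≡ Available (graph (other s)) (M (other s)) v w
        same-availability w w≢pL with onPath? p L w
        ... | inj₂ w-off = cong₂ _∧_
          (graph-away-from-u v≢u (λ w≡u → w-off 0 z≤n (trans w≡u (sym starts))) s (other s))
          (isFree-resp (M s) (M (other s)) (agree-off-at w-off s (other s)))
        ... | inj₁ (i , i≤L , refl) with ℕ.m≤n⇒m<n∨m≡n i≤L
        ...   | inj₁ i<L  =
          trans (path-unavailable s v i≤L (inj₁ i<L)) (sym (path-unavailable (other s) v i≤L (inj₁ i<L)))
        ...   | inj₂ refl = ⊥-elim (w≢pL refl)

        same-choice : firstFree (graph s) (M s) v (pref v) ≡ firstFree (graph (other s)) (M (other s)) v (pref v)
                    → Alternating (stepBoth M v)
        same-choice same with firstFree (graph (other s)) (M (other s)) v (pref v) in chosen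
        ... | nothing =
          unchanged (both-sides s (G.step-stuck s (free s) same) (G.step-stuck (other s) (free (other s)) chosen)) alt
        ... | just w  = p , L , add-offPath-edge alt v-off w-off
                                  (λ t → G.step-adds-chosen t (graph-loopless t) (free t) (both-sides s same chosen t))
          where
          w-off : OffPath p L w
          w-off = available-offPath (G.chosen-available (other s) chosen) (inj₁ refl)

        N₁ : Mates
        N₁ = M [ s ≔ addEdge (M s) v (p L) ]

        alt₁ : AlternatingPath N₁ (extend p L v) (suc L)
        alt₁ = extend-alternating alt v-off (free s) below added (cong-app (update-other M s _))
          where
          below : ∀ j → suc j ≡ L → dt (p j) (p L) ℚ.≤ y v
          below j 1+j≡L = subst (λ k → dt (p j) (p k) ℚ.≤ y v) 1+j≡L
            (ℚ.<⇒≤ (decided-before (Greedy.Processed.covered (processed (side j)))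
                                   (forward (edge j (ℕ.≤-reflexive 1+j≡L)))))
          added : Adds (M s) (N₁ s) (p L) v
          added = subst (λ m → Adds (M s) m (p L) v) (sym (update-here M s _))
                    (adds-sym (addEdge-adds (v-off L ℕ.≤-refl)))

        via-end : firstFree (graph s) (M s) v (pref v) ≡ just (p L) → Alternating (stepBoth M v)
        via-end chose-end with G.stepCase (other s) (M (other s)) v
        ... | G.matched (_ , mv) _ with () ← trans (sym (free (other s))) mv
        ... | G.stuck _ _ same = extend p L v , suc L , alternating-resp (both-sides s this-side that-side) alt₁
          where
          this-side : ∀ x → N₁ s x ≡ stepBoth M v s x
          this-side = cong-app (trans (update-here M s _) (sym (G.step-adds s (free s) chose-end)))
          that-side : ∀ x → N₁ (other s) x ≡ stepBoth M v (other s) x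
          that-side = cong-app (trans (update-other M s _) (sym same))
        ... | G.adds {w} _ chosen _ = extend (extend p L v) (suc L) w , suc (suc L) ,
              extend-alternating alt₁ w-off w-free below added settled
          where
          p₁ = extend p L v
          last : p₁ (suc L) ≡ v
          last = extend-last {p = p} {L} {v}
          avail₁ : Available (graph (other s)) (N₁ (other s)) v w ≡ true
          avail₁ = subst (λ m → Available (graph (other s)) m v w ≡ true) (sym (update-other M s _))
                     (G.chosen-available (other s) chosen)
          w-off : OffPath p₁ (suc L) w
          w-off = Path.available-offPath alt₁ avail₁ (inj₂ λ w≡ →
            loopless-≢ (graph-loopless (other s)) (G.chosen-edge (other s) chosen) (sym (trans w≡ last)))
          w-free : N₁ (other s) w ≡ nothing
          w-free = trans (cong-app (update-other M s _) w) (G.chosen-free (other s) chosen)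
          below : ∀ j → suc j ≡ suc L → dt (p₁ j) (p₁ (suc L)) ℚ.≤ y w
          below = last-edge-below (subst (λ a → y a ℚ.≤ y w) (sym last)
            (ℚ.<⇒≤ (available-after-at (other s) (free (other s)) (G.chosen-available (other s) chosen))))
          added : Adds (N₁ (other s)) (stepBoth M v (other s)) (p₁ (suc L)) w
          added = subst₂ (λ m a → Adds m (stepBoth M v (other s)) a w) (sym (update-other M s _)) (sym last)
                    (G.step-adds-chosen (other s) (graph-loopless (other s)) (free (other s)) chosen)
          settled : ∀ z → stepBoth M v (other (other s)) z ≡ N₁ (other (other s)) z
          settled = subst (λ t → ∀ z → stepBoth M v t z ≡ N₁ t z) (sym (other-involutive s))
                   (cong-app (trans (G.step-adds s (free s) chose-end) (sym (update-here M s _))))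

        step-off-path-free : Alternating (stepBoth M v)
        step-off-path-free with firstFree-except {G₁ = graph s} {graph (other s)} {M s} {M (other s)} {v} {p L}
                                  (pref v) same-availability end-unavailable
        ... | inj₁ same      = same-choice same
        ... | inj₂ chose-end = via-end chose-end

      step-off-path : OffPath p L v → Alternating (stepBoth M v)
      step-off-path v-off with M full v in mv
      ... | just a  = unchanged (λ t → G.step-matched t (a , trans (agree-off-at v-off t full) mv)) alt
      ... | nothing = FreeOffPath.step-off-path-free v-off (λ t → trans (agree-off-at v-off t full) mv)

      step-alternating : Alternating (stepBoth M v)
      step-alternating with onPath? p L v
      ... | inj₂ v-off = step-off-path v-off
      ... | inj₁ (k , k≤L , v≡pk) with ℕ.m≤n⇒m<n∨m≡n k≤L
      ...   | inj₁ k<L  = unchanged (λ t → step-on-path-blocked t k≤L v≡pk (inj₁ k<L)) alt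
      ...   | inj₂ refl = step-end v≡pk

  record Reachable (P : List (Fin n)) (M : Mates) : Set where
    field
      processed   : ∀ t → Greedy.Processed pref (graph t) P (M t)
      alternating : Alternating M

  reachable-start : Reachable [] (λ _ → emptyMate)
  reachable-start = record
    { processed   = λ t → Greedy.processed-[] pref (graph t)
    ; alternating = (λ _ → u) , 0 , record
        { injective = λ { 0 0 z≤n z≤n _ → refl }
        ; starts    = refl
        ; edge      = λ _ ()
        ; agree-off = λ _ _ → refl
        ; end-free  = refl
        ; monotone  = λ _ ()
        }
    }

  reachable-step : ∀ {P v rest M}
                 → AllPairs (λ a b → y a ℚ.< y b) (P ++ v ∷ rest) → (∀ x → x ∈ P ++ v ∷ rest)
                 → Reachable P M → Reachable (P ++ [ v ]) (stepBoth M v)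
  reachable-step {v = v} sorted everyone reach = record
    { processed   = λ t → Greedy.processed-step pref (graph t) v (pref-complete v) (processed t)
    ; alternating = Step.step-alternating sorted everyone processed (proj₂ (proj₂ alternating))
    }
    where open Reachable reach

  reachable-run : ∀ rest {P M} → AllPairs (λ a b → y a ℚ.< y b) (P ++ rest) → (∀ x → x ∈ P ++ rest)
                → Reachable P M → Alternating (foldl stepBoth M rest)
  reachable-run []         _      _        reach = Reachable.alternating reach
  reachable-run (v ∷ rest) {P} sorted everyone reach =
    reachable-run rest (subst (AllPairs _) reassociate sorted) (λ x → subst (x ∈_) reassociate (everyone x))
      (reachable-step sorted everyone reach)
    where
    reassociate : P ++ v ∷ rest ≡ (P ++ [ v ]) ++ rest
    reassociate = sym (++-assoc P [ v ] rest)

  rdo-alternating : ∀ σ → AllPairs (λ a b → y a ℚ.< y b) σ → (∀ x → x ∈ σ)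
                  → Alternating (λ t → RDO (graph t) pref σ)
  rdo-alternating σ sorted everyone with reachable-run σ {[]} sorted everyone reachable-start
  ... | p , L , alt = p , L , alternating-resp (λ t → cong-app (run-at σ (λ _ → emptyMate) t)) alt

  rdo-u-free : ∀ σ → RDO (deleteVertex E u) pref σ u ≡ nothing
  rdo-u-free = Greedy.rdo-isolated pref (graph deleted) (graph-symmetric deleted) (deleteVertex-isolated E u)

  module Outcome {M : Mates} {p : ℕ → Fin n} {L : ℕ} (alt : AlternatingPath M p L)
                 (u-free : M deleted u ≡ nothing) where
    open AlternatingPath alt public
    open Path alt

    length-positive : ∀ {w} → M full u ≡ just w → 1 ≤ L
    length-positive u↦w = ℕ.n≢0⇒n>0 L≢0
      where
      L≢0 : L ≢ 0
      L≢0 L≡0 with () ← trans (sym (subst (λ x → M full x ≡ nothing) starts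
                               (subst (λ k → M (side k) (p k) ≡ nothing) L≡0 end-free))) u↦w

    edge-parity : ∀ i → i < L → (Even i → InMatching (M full) (p i) (p (suc i)))
                              × (Odd i → InMatching (M deleted) (p i) (p (suc i)))
    edge-parity i i<L =
      (λ even → subst (λ s → M s (p i) ≡ just (p (suc i))) (side-even i even) (forward (edge i i<L))) ,
      (λ odd  → subst (λ s → M s (p i) ≡ just (p (suc i))) (side-odd i odd) (forward (edge i i<L)))

    mate-edge : ∀ {t a b i} → i ≤ L → a ≡ p i → M t a ≡ just b
              → Σ ℕ λ k → k < L × t ≡ side k × PathEdge p k a b
    mate-edge i≤L refl mate with mate-on-path u-free i≤L mate
    ... | inj₁ (t≡ , i<L , refl)       = _ , i<L , t≡ , inj₁ (refl , refl)
    ... | inj₂ (j , refl , t≡ , refl) = j , i≤L , t≡ , inj₂ (refl , refl)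

    symDiff-sides : ∀ {a b} → InSymDiff (M full) (M deleted) a b
                  → Σ Side λ t → M t a ≡ just b × ¬ M (other t) a ≡ just b
    symDiff-sides (inj₁ differ) = full , differ
    symDiff-sides (inj₂ differ) = deleted , differ

    sides-symDiff : ∀ t {a b} → M t a ≡ just b → ¬ M (other t) a ≡ just b → InSymDiff (M full) (M deleted) a b
    sides-symDiff full    mate not = inj₁ (mate , not)
    sides-symDiff deleted mate not = inj₂ (mate , not)

    symDiff⇒onPath : ∀ a b → InSymDiff (M full) (M deleted) a b → OnPath p L a b
    symDiff⇒onPath a b differ with symDiff-sides differ
    ... | t , mate , not with onPath? p L a
    ...   | inj₂ a-off = ⊥-elim (not (trans (agree-off-at a-off (other t) t) mate))
    ...   | inj₁ (i , i≤L , a≡pi) with mate-edge i≤L a≡pi mate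
    ...     | k , k<L , _ , on-edge = k , k<L , on-edge

    onPath⇒symDiff : ∀ a b → OnPath p L a b → InSymDiff (M full) (M deleted) a b
    onPath⇒symDiff a b (k , k<L , on-edge) = sides-symDiff (side k) (mate on-edge) not-other
      where
      mate : ∀ {a b} → PathEdge p k a b → M (side k) a ≡ just b
      mate (inj₁ (refl , refl)) = forward (edge k k<L)
      mate (inj₂ (refl , refl)) = backward (edge k k<L)
      endpoint : PathEdge p k a b → Σ ℕ λ i → i ≤ L × a ≡ p i
      endpoint (inj₁ (a≡ , _)) = k , ℕ.<⇒≤ k<L , a≡
      endpoint (inj₂ (_ , a≡)) = suc k , k<L , a≡
      not-other : ¬ M (other (side k)) a ≡ just b
      not-other mate′ with endpoint on-edge
      ... | _ , i≤L , a≡pi with mate-edge i≤L a≡pi mate′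
      ...   | k′ , k′<L , other≡ , on-edge′ =
        s≢other-s (side k)
          (sym (trans other≡ (cong side (sym (pathEdge-unique injective k<L k′<L on-edge on-edge′)))))

    matched-no-later : ∀ i → i ≤ L → Odd i → ∀ v w → M full (p i) ≡ just v → M deleted (p i) ≡ just w
                     → dt (p i) v ℚ.≤ dt (p i) w
    matched-no-later i i≤L odd v w full-mate deleted-mate
      with mate-on-path u-free i≤L full-mate | mate-on-path u-free i≤L deleted-mate
    ... | inj₁ (full≡ , _) | _ with () ← trans full≡ (side-odd i odd)
    ... | inj₂ (j , refl , _ , refl) | inj₂ (_ , refl , deleted≡ , _)
      with () ← subst (λ s → other s ≡ deleted) (sym deleted≡) (side-odd i odd)
    ... | inj₂ (j , refl , _ , refl) | inj₁ (_ , i<L , refl) =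
      ℚ.≤-trans (ℚ.≤-reflexive (ℚ.⊓-comm (y (p (suc j))) (y (p j)))) (monotone j i<L)

↭-allFin-complete : ∀ {xs : List (Fin n)} → xs ↭ allFin n → ∀ x → x ∈ xs
↭-allFin-complete xs↭allFin x = ∈-resp-↭ (↭-sym xs↭allFin) (∈-allFin x)

lemma3 : (n : ℕ) (E : Graph n) → IsSimpleGraph E
    → (pref : Fin n → List (Fin n)) → ((v : Fin n) → pref v ↭ allFin n)
    → (y : Fin n → ℚ) → ((v : Fin n) → (0ℚ ℚ.≤ y v) × (y v ℚ.≤ 1ℚ))
    → (σ : List (Fin n)) → σ ↭ allFin n → AllPairs (λ a b → y a ℚ.< y b) σ
    → (u : Fin n) → Σ (Fin n) (λ w → RDO E pref σ u ≡ just w)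
    → Σ ℕ λ L → Σ (ℕ → Fin n) λ p →
        (1 ≤ L) × (p 0 ≡ u)
        × ((i j : ℕ) → i ≤ L → j ≤ L → p i ≡ p j → i ≡ j)
        × ((i : ℕ) → i < L →
             (Even i → InMatching (RDO E pref σ) (p i) (p (suc i)))
             × (Odd i → InMatching (RDO (deleteVertex E u) pref σ) (p i) (p (suc i))))
        × ((a b : Fin n) →
             (InSymDiff (RDO E pref σ) (RDO (deleteVertex E u) pref σ) a b → OnPath p L a b)
             × (OnPath p L a b → InSymDiff (RDO E pref σ) (RDO (deleteVertex E u) pref σ) a b))
        × ((i : ℕ) → suc i < L →
             decisionTime y (p i) (p (suc i)) ℚ.≤ decisionTime y (p (suc i)) (p (suc (suc i))))
        × ((i : ℕ) → i ≤ L → Odd i → (v w : Fin n)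
             → RDO E pref σ (p i) ≡ just v
             → RDO (deleteVertex E u) pref σ (p i) ≡ just w
             → decisionTime y (p i) v ℚ.≤ decisionTime y (p i) w)
-- Only the order of the ranks matters.
lemma3 n E simple pref pref-perm y _ σ σ-perm sorted u (_ , u↦w) =
  L , p , length-positive u↦w , starts , injective , edge-parity
  , (λ a b → symDiff⇒onPath a b , onPath⇒symDiff a b) , monotone , matched-no-later
  where
  open Deletion E simple pref (λ v → ↭-allFin-complete (pref-perm v)) y u
  path : Alternating (λ t → RDO (graph t) pref σ)
  path = rdo-alternating σ sorted (↭-allFin-complete σ-perm)
  p : ℕ → Fin n
  p = proj₁ path
  L : ℕ
  L = proj₁ (proj₂ path)
  open Outcome (proj₂ (proj₂ path)) (rdo-u-free σ)
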